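{- Let $\mathcal{A}$ be a bounded distributive lattice, let $(\mathcal{B}, \to_{\mathcal{B}})$ be a strong algebra, let $f: \mathcal{A} \to \mathcal{B}$ be an order-preserving map and let $g: \mathcal{B} \to \mathcal{A}$ be a map preserving all finite meets. Define $a \to_{\mathcal{A}} b = g(f(a) \to_{\mathcal{B}} f(b))$ for $a, b \in \mathcal{A}$. Then: (i) if $\to_{\mathcal{B}}$ is open, $f$ preserves binary meets and $g(f(a)) \geq a$ for all $a \in \mathcal{A}$, then $\to_{\mathcal{A}}$ is an open implication over $\mathcal{A}$; (ii) if $\to_{\mathcal{B}}$ is closed, $f$ preserves binary joins, and for all $a \in \mathcal{A}$ and $c \in \mathcal{B}$, $c \vee f(a) = 1$ implies $g(c) \vee a = 1$, then $\to_{\mathcal{A}}$ is a closed implication over $\mathcal{A}$.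
   Context: For a bounded distributive lattice $\mathcal{A}$, an implication over $\mathcal{A}$ is a binary operation $\to$ on $\mathcal{A}$ which is order-reversing in its first argument and order-preserving in its second argument and satisfies $a \to a = 1$ and $(a \to b) \wedge (b \to c) \leq a \to c$ for all $a,b,c$. A strong algebra is a pair $(\mathcal{A},\to)$ of a bounded distributive lattice and an implication over it. An implication is open if for all $a,b,c$, $a \wedge b \leq c$ implies $a \leq b \to c$; it is closed if for all $a,b,c$, $a \leq b \vee c$ implies $(a \to b) \vee c = 1$. -}

module Defs where

open import Level using (Level; _⊔_; suc)
open import Algebra.Definitions using (_DistributesOverˡ_)
open import Relation.Binary.Lattice.Bundles using (BoundedLattice)
open import Data.Product using (_×_)
open import Relation.Binary.Core using (Rel; _Preserves_⟶_; _Preserves₂_⟶_⟶_)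

record BoundedDistributiveLattice c ℓ₁ ℓ₂ : Set (suc (c ⊔ ℓ₁ ⊔ ℓ₂)) where
  field
    boundedLattice : BoundedLattice c ℓ₁ ℓ₂
  open BoundedLattice boundedLattice public
  field
    ∧-distribˡ-∨ : _DistributesOverˡ_ _≈_ _∧_ _∨_

module _ {c ℓ₁ ℓ₂} (L : BoundedDistributiveLattice c ℓ₁ ℓ₂) where
  open BoundedDistributiveLattice L

  -- An implication over L (a binary operation on the carrier; it is required
  -- to respect the setoid equality, which is automatic when ≈ is ≡).
  record IsImplication (_⇒_ : Carrier → Carrier → Carrier) : Set (c ⊔ ℓ₁ ⊔ ℓ₂) where
    field
      cong      : _⇒_ Preserves₂ _≈_ ⟶ _≈_ ⟶ _≈_
      antitoneˡ : ∀ {a a′ b} → a ≤ a′ → (a′ ⇒ b) ≤ (a ⇒ b)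
      monotoneʳ : ∀ {a b b′} → b ≤ b′ → (a ⇒ b) ≤ (a ⇒ b′)
      refl⇒     : ∀ a → (a ⇒ a) ≈ ⊤
      trans⇒    : ∀ a b c′ → ((a ⇒ b) ∧ (b ⇒ c′)) ≤ (a ⇒ c′)

  IsOpen : (Carrier → Carrier → Carrier) → Set (c ⊔ ℓ₂)
  IsOpen _⇒_ = ∀ a b c′ → (a ∧ b) ≤ c′ → a ≤ (b ⇒ c′)

  IsClosed : (Carrier → Carrier → Carrier) → Set (c ⊔ ℓ₁ ⊔ ℓ₂)
  IsClosed _⇒_ = ∀ a b c′ → a ≤ (b ∨ c′) → ((a ⇒ b) ∨ c′) ≈ ⊤

record StrongAlgebra c ℓ₁ ℓ₂ : Set (suc (c ⊔ ℓ₁ ⊔ ℓ₂)) where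
  field
    bdl           : BoundedDistributiveLattice c ℓ₁ ℓ₂
  open BoundedDistributiveLattice bdl public
  field
    _⇒_           : Carrier → Carrier → Carrier
    isImplication : IsImplication bdl _⇒_

module _ {a ℓa₁ ℓa₂ b ℓb₁ ℓb₂}
         (A : BoundedDistributiveLattice a ℓa₁ ℓa₂)
         (B : BoundedDistributiveLattice b ℓb₁ ℓb₂) where
  private
    module A = BoundedDistributiveLattice A
    module B = BoundedDistributiveLattice B

  OrderPreserving : (A.Carrier → B.Carrier) → Set (a ⊔ ℓa₂ ⊔ ℓb₂)
  OrderPreserving f = ∀ {x y} → x A.≤ y → f x B.≤ f y

  PreservesFiniteMeets : (A.Carrier → B.Carrier) → Set (a ⊔ ℓa₁ ⊔ ℓb₁)
  PreservesFiniteMeets g =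
    (∀ {x y} → x A.≈ y → g x B.≈ g y) ×
    (g A.⊤ B.≈ B.⊤) ×
    (∀ x y → g (x A.∧ y) B.≈ (g x B.∧ g y))

  PreservesBinaryMeets : (A.Carrier → B.Carrier) → Set (a ⊔ ℓb₁)
  PreservesBinaryMeets f = ∀ x y → f (x A.∧ y) B.≈ (f x B.∧ f y)

  PreservesBinaryJoins : (A.Carrier → B.Carrier) → Set (a ⊔ ℓb₁)
  PreservesBinaryJoins f = ∀ x y → f (x A.∨ y) B.≈ (f x B.∨ f y)

{-# OPTIONS --safe #-}
-- Each law of the induced implication is the corresponding law of →_B transported
-- along f and back along g: f carries the hypothesis from A to B, and g, which is
-- monotone and preserves ⊤ and ∧, carries the conclusion back.  For openness the
-- inequality a ≤ g (f a) performs the return trip; for closedness the condition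
-- on c ∨ f a = 1 does.
module Submission where

open import Data.Product using (_×_; _,_)
open import Defs
import Relation.Binary.Lattice.Properties.MeetSemilattice as MeetSemilatticeProperties
import Relation.Binary.Reasoning.PartialOrder as PartialOrderReasoning

module _ {a ℓa₁ ℓa₂ b ℓb₁ ℓb₂}
         (A : BoundedDistributiveLattice a ℓa₁ ℓa₂)
         (B : BoundedDistributiveLattice b ℓb₁ ℓb₂) where
  private
    module A = BoundedDistributiveLattice A
    module B = BoundedDistributiveLattice B

  orderPreserving⇒cong : ∀ {f} → OrderPreserving A B f →
                         ∀ {x y} → x A.≈ y → f x B.≈ f y
  orderPreserving⇒cong f-mono x≈y =
    B.antisym (f-mono (A.reflexive x≈y)) (f-mono (A.reflexive (A.Eq.sym x≈y)))

  preservesBinaryMeets⇒orderPreserving : ∀ {g} → (∀ {x y} → x A.≈ y → g x B.≈ g y) →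
                                         PreservesBinaryMeets A B g → OrderPreserving A B g
  preservesBinaryMeets⇒orderPreserving {g} g-cong g-∧ {x} {y} x≤y = begin
    g x          ≈˘⟨ g-cong (y≤x⇒x∧y≈y x≤y) ⟩
    g (y A.∧ x)  ≈⟨ g-∧ y x ⟩
    g y B.∧ g x  ≤⟨ B.x∧y≤x _ _ ⟩
    g y          ∎
    where
    open MeetSemilatticeProperties A.meetSemilattice using (y≤x⇒x∧y≈y)
    open PartialOrderReasoning B.poset

module Induced {a ℓa₁ ℓa₂ b ℓb₁ ℓb₂}
               (A : BoundedDistributiveLattice a ℓa₁ ℓa₂)
               (B : BoundedDistributiveLattice b ℓb₁ ℓb₂)
               (_⇒_ : BoundedDistributiveLattice.Carrier B →
                      BoundedDistributiveLattice.Carrier B →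
                      BoundedDistributiveLattice.Carrier B)
               (f : BoundedDistributiveLattice.Carrier A → BoundedDistributiveLattice.Carrier B)
               (g : BoundedDistributiveLattice.Carrier B → BoundedDistributiveLattice.Carrier A)
               where
  private
    module A = BoundedDistributiveLattice A
    module B = BoundedDistributiveLattice B

  _⇒ᴬ_ : A.Carrier → A.Carrier → A.Carrier
  x ⇒ᴬ y = g (f x ⇒ f y)

  isImplication : OrderPreserving A B f → PreservesFiniteMeets B A g →
                  IsImplication B _⇒_ → IsImplication A _⇒ᴬ_
  isImplication f-mono (g-cong , g-⊤ , g-∧) ⇒-isImplication = record
    { cong      = λ x≈x′ y≈y′ → g-cong (⇒.cong (f-cong x≈x′) (f-cong y≈y′))
    ; antitoneˡ = λ x≤x′ → g-mono (⇒.antitoneˡ (f-mono x≤x′))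
    ; monotoneʳ = λ y≤y′ → g-mono (⇒.monotoneʳ (f-mono y≤y′))
    ; refl⇒     = λ x → A.Eq.trans (g-cong (⇒.refl⇒ (f x))) g-⊤
    ; trans⇒    = trans⇒
    }
    where
    module ⇒ = IsImplication ⇒-isImplication

    f-cong : ∀ {x y} → x A.≈ y → f x B.≈ f y
    f-cong = orderPreserving⇒cong A B f-mono

    g-mono : OrderPreserving B A g
    g-mono = preservesBinaryMeets⇒orderPreserving B A g-cong g-∧

    trans⇒ : ∀ x y z → ((x ⇒ᴬ y) A.∧ (y ⇒ᴬ z)) A.≤ (x ⇒ᴬ z)
    trans⇒ x y z = begin
      g (f x ⇒ f y) A.∧ g (f y ⇒ f z)  ≈˘⟨ g-∧ _ _ ⟩
      g ((f x ⇒ f y) B.∧ (f y ⇒ f z))  ≤⟨ g-mono (⇒.trans⇒ (f x) (f y) (f z)) ⟩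
      g (f x ⇒ f z)                    ∎
      where open PartialOrderReasoning A.poset

  isOpen : OrderPreserving A B f → OrderPreserving B A g →
           PreservesBinaryMeets A B f → (∀ x → x A.≤ g (f x)) →
           IsOpen B _⇒_ → IsOpen A _⇒ᴬ_
  isOpen f-mono g-mono f-∧ x≤gfx ⇒-open x y z x∧y≤z = begin
    x              ≤⟨ x≤gfx x ⟩
    g (f x)        ≤⟨ g-mono (⇒-open (f x) (f y) (f z) fx∧fy≤fz) ⟩
    g (f y ⇒ f z)  ∎
    where
    open PartialOrderReasoning A.poset

    fx∧fy≤fz : (f x B.∧ f y) B.≤ f z
    fx∧fy≤fz = B.trans (B.reflexive (B.Eq.sym (f-∧ x y))) (f-mono x∧y≤z)

  isClosed : OrderPreserving A B f → PreservesBinaryJoins A B f →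
             (∀ x c → (c B.∨ f x) B.≈ B.⊤ → (g c A.∨ x) A.≈ A.⊤) →
             IsClosed B _⇒_ → IsClosed A _⇒ᴬ_
  isClosed f-mono f-∨ reflect-⊤ ⇒-closed x y z x≤y∨z =
    reflect-⊤ z (f x ⇒ f y) (⇒-closed (f x) (f y) (f z) fx≤fy∨fz)
    where
    fx≤fy∨fz : f x B.≤ (f y B.∨ f z)
    fx≤fy∨fz = B.trans (f-mono x≤y∨z) (B.reflexive (f-∨ y z))

theorem3p10 : ∀ {a ℓa₁ ℓa₂ b ℓb₁ ℓb₂}
    (A : BoundedDistributiveLattice a ℓa₁ ℓa₂) (B : StrongAlgebra b ℓb₁ ℓb₂)
    (f : BoundedDistributiveLattice.Carrier A → StrongAlgebra.Carrier B)
    (g : StrongAlgebra.Carrier B → BoundedDistributiveLattice.Carrier A) →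
    OrderPreserving A (StrongAlgebra.bdl B) f →
    PreservesFiniteMeets (StrongAlgebra.bdl B) A g →
    ((IsOpen (StrongAlgebra.bdl B) (StrongAlgebra._⇒_ B) →
      PreservesBinaryMeets A (StrongAlgebra.bdl B) f →
      (∀ x → BoundedDistributiveLattice._≤_ A x (g (f x))) →
      IsImplication A (λ x y → g (StrongAlgebra._⇒_ B (f x) (f y)))
      × IsOpen A (λ x y → g (StrongAlgebra._⇒_ B (f x) (f y))))
    × (IsClosed (StrongAlgebra.bdl B) (StrongAlgebra._⇒_ B) →
      PreservesBinaryJoins A (StrongAlgebra.bdl B) f →
      (∀ x c → StrongAlgebra._≈_ B (StrongAlgebra._∨_ B c (f x)) (StrongAlgebra.⊤ B) →
        BoundedDistributiveLattice._≈_ A (BoundedDistributiveLattice._∨_ A (g c) x) (BoundedDistributiveLattice.⊤ A)) →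
      IsImplication A (λ x y → g (StrongAlgebra._⇒_ B (f x) (f y)))
      × IsClosed A (λ x y → g (StrongAlgebra._⇒_ B (f x) (f y)))))
theorem3p10 A B f g f-mono g-meets@(g-cong , _ , g-∧) =
    (λ ⇒-open f-∧ x≤gfx → ⇒ᴬ-isImplication , isOpen f-mono g-mono f-∧ x≤gfx ⇒-open)
  , (λ ⇒-closed f-∨ reflect-⊤ → ⇒ᴬ-isImplication , isClosed f-mono f-∨ reflect-⊤ ⇒-closed)
  where
  module B = StrongAlgebra B
  open Induced A B.bdl B._⇒_ f g

  ⇒ᴬ-isImplication : IsImplication A _⇒ᴬ_
  ⇒ᴬ-isImplication = isImplication f-mono g-meets B.isImplication

  g-mono : OrderPreserving B.bdl A g
  g-mono = preservesBinaryMeets⇒orderPreserving B.bdl A g-cong g-∧
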